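{- Let $k\geq 3$ be an integer and let $G=(V,E)$ be a graph on $n$ vertices with girth at least $2k+1$. Define $V_{low}=\{v\in V: d_1(v)\leq n^{1/k}\}$, $V_{med}=\{v\in V: n^{(k-2)/(k-1)}d_1(v)^{1/(k-1)}\leq d_{k-1}(v)\}$, and for each integer $0\leq j\leq\lfloor (k-3)/2\rfloor$, $V_{high,j}=\{v\in V: d_{k-2j-1}(v)\leq n^{1/(k-1)}d_{k-2j-3}(v)\,d_1(v)^{(k-2)/(k-1)}\}$. Then $V=V_{low}\cup V_{med}\cup\bigcup_{0\leq j\leq\lfloor(k-3)/2\rfloor}V_{high,j}$.
   Context: For a vertex $v$ and integer $i\geq 0$, $N_i(v)$ is the set of vertices at hop distance exactly $i$ from $v$ and $d_i(v)=|N_i(v)|$; in particular $d_0(v)=1$ and $d_1(v)$ is the degree of $v$. The girth is the length of a shortest cycle (infinite for acyclic graphs). -}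

module Defs where

open import Data.Bool using (Bool; true; false; _∧_)
open import Data.Nat using (ℕ; zero; suc; _+_; _*_; _∸_; _^_; _≤_; _<_)
open import Data.Fin using (Fin; zero; suc; inject₁; fromℕ)
open import Data.Fin.Subset using (Subset; ⁅_⁆; _∪_; _∩_; ∁; ∣_∣)
open import Data.Vec using (tabulate; lookup)
open import Data.List using (allFin)
open import Data.Bool.ListAction using (any)
open import Data.Product using (Σ; _×_)
open import Function.Definitions using (Injective)
open import Relation.Binary.PropositionalEquality using (_≡_)
open import Relation.Nullary using (¬_)

record Graph (n : ℕ) : Set where
  field
    Adj    : Fin n → Fin n → Bool
    sym    : ∀ u v → Adj u v ≡ Adj v u
    irrefl : ∀ v → Adj v v ≡ false
open Graph public

-- A cycle of length (3 + m): distinct vertices f 0, …, f (2+m), consecutive ones adjacent,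
-- and the last adjacent to the first.
Cycle : ∀ {n} → Graph n → ℕ → Set
Cycle {n} G m =
  Σ (Fin (3 + m) → Fin n) λ f →
    Injective _≡_ _≡_ f
    × (∀ (i : Fin (2 + m)) → Adj G (f (inject₁ i)) (f (suc i)) ≡ true)
    × (Adj G (f (fromℕ (2 + m))) (f zero) ≡ true)

GirthAtLeast : ∀ {n} → Graph n → ℕ → Set
GirthAtLeast G g = ∀ m → 3 + m < g → ¬ Cycle G m

step : ∀ {n} → Graph n → Subset n → Subset n
step {n} G S = tabulate λ w → any (λ u → lookup S u ∧ Adj G u w) (allFin n)

ball : ∀ {n} → Graph n → Fin n → ℕ → Subset n
ball G v zero    = ⁅ v ⁆
ball G v (suc i) = ball G v i ∪ step G (ball G v i)

sphere : ∀ {n} → Graph n → Fin n → ℕ → Subset n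
sphere G v zero    = ⁅ v ⁆
sphere G v (suc i) = ball G v (suc i) ∩ ∁ (ball G v i)

d : ∀ {n} → Graph n → ℕ → Fin n → ℕ
d G i v = ∣ sphere G v i ∣

-- The vertex classes, with real-exponent inequalities between nonnegative
-- quantities raised to integer powers (equivalent since x ↦ x^p is monotone on ℝ≥0):
-- d_1 ≤ n^{1/k}  ⇔  d_1^k ≤ n
Vlow : ∀ {n} → Graph n → ℕ → Fin n → Set
Vlow {n} G k v = d G 1 v ^ k ≤ n

-- n^{(k-2)/(k-1)} d_1^{1/(k-1)} ≤ d_{k-1}  ⇔  n^{k-2} d_1 ≤ d_{k-1}^{k-1}
Vmed : ∀ {n} → Graph n → ℕ → Fin n → Set
Vmed {n} G k v = n ^ (k ∸ 2) * d G 1 v ≤ d G (k ∸ 1) v ^ (k ∸ 1)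

-- d_{k-2j-1} ≤ n^{1/(k-1)} d_{k-2j-3} d_1^{(k-2)/(k-1)}
--   ⇔  d_{k-2j-1}^{k-1} ≤ n · d_{k-2j-3}^{k-1} · d_1^{k-2}
Vhigh : ∀ {n} → Graph n → ℕ → ℕ → Fin n → Set
Vhigh {n} G k j v =
  d G (k ∸ 2 * j ∸ 1) v ^ (k ∸ 1) ≤ n * d G (k ∸ 2 * j ∸ 3) v ^ (k ∸ 1) * d G 1 v ^ (k ∸ 2)

module Submission where

-- The covering V = V_low ∪ V_med ∪ ⋃_j V_high,j is a purely arithmetic fact
-- about the sphere sizes d_i(v).
--
-- Write k = 3 + b + 2J with b ∈ {0,1} and J = ⌊(k-3)/2⌋, put a = d_1(v),
-- c = n·a^(k-2) and Z_j = d_{k-2j-1}(v)^(k-1), so that Z_0 = d_{k-1}^(k-1),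
-- Z_(J+1) = d_b^(k-1) = (a^b)^(k-1), and v ∈ V_high,j says exactly Z_j ≤ c·Z_(j+1).
-- A telescoping argument shows: either some j ≤ J has Z_j ≤ c·Z_(j+1)
-- (v ∈ V_high,j), or c^(J+1)·Z_(J+1) ≤ Z_0.  In the latter case, if moreover
-- v ∉ V_low, i.e. n ≤ a^k, then the power bookkeeping lemma below gives
-- n^(k-2)·a ≤ c^(J+1)·(a^b)^(k-1) ≤ d_{k-1}^(k-1), i.e. v ∈ V_med.

open import Defs hiding (sym)
open import Data.Nat using (ℕ; zero; suc; _+_; _*_; _∸_; _^_; _≤_; _<_; _/_; _%_; z≤n; s≤s; s≤s⁻¹; _≤?_)
open import Data.Nat.Properties
open import Data.Nat.DivMod using (m≡m%n+[m/n]*n; m%n<n)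
open import Data.Nat.Tactic.RingSolver using (solve-∀)
open import Algebra.Properties.CommutativeSemigroup *-commutativeSemigroup using (x∙yz≈y∙xz; xy∙z≈x∙zy; xy∙z≈xz∙y)
open import Data.Fin using (Fin)
open import Data.Fin.Subset.Properties using (∣⁅x⁆∣≡1)
open import Data.Sum using (_⊎_; inj₁; inj₂)
open import Data.Product using (Σ; _×_; _,_)
open import Relation.Nullary using (yes; no)
open import Relation.Binary.PropositionalEquality using (_≡_; refl; sym; trans; cong; cong₂; subst)

*-^-distrib : ∀ x y o → (x * y) ^ o ≡ x ^ o * y ^ o
*-^-distrib x y zero    = refl
*-^-distrib x y (suc o) = trans (cong (x * y *_) (*-^-distrib x y o)) (regroup x y (x ^ o) (y ^ o))
  where
  regroup : ∀ x y X Y → x * y * (X * Y) ≡ x * X * (y * Y)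
  regroup = solve-∀

telescope : (c : ℕ) (Z : ℕ → ℕ) (J : ℕ) →
  Σ ℕ (λ j → j < J × Z j ≤ c * Z (suc j)) ⊎ c ^ J * Z J ≤ Z 0
telescope c Z zero = inj₂ (≤-reflexive (+-identityʳ (Z 0)))
telescope c Z (suc J) with telescope c Z J
... | inj₁ (j , j<J , step) = inj₁ (j , m≤n⇒m≤1+n j<J , step)
... | inj₂ bound with Z J ≤? c * Z (suc J)
...   | yes step = inj₁ (J , ≤-refl , step)
...   | no noStep = inj₂ (begin
        c * c ^ J * Z (suc J)   ≡⟨ *-assoc c (c ^ J) (Z (suc J)) ⟩
        c * (c ^ J * Z (suc J)) ≡⟨ x∙yz≈y∙xz c (c ^ J) (Z (suc J)) ⟩
        c ^ J * (c * Z (suc J)) ≤⟨ *-monoʳ-≤ (c ^ J) (<⇒≤ (≰⇒> noStep)) ⟩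
        c ^ J * Z J             ≤⟨ bound ⟩
        Z 0                     ∎)
  where open ≤-Reasoning

-- Writing k = 3 + b + 2J, the exponents of a on both sides of the V_med
-- estimate agree; this is where b ∈ {0,1} (b² = b) is used.
exponent-identity : ∀ b J → b ≤ 1 →
  suc ((3 + b + 2 * J) * (J + b)) ≡ (1 + b + 2 * J) * suc J + b * (2 + b + 2 * J)
exponent-identity zero    J z≤n       = even J
  where
  even : ∀ J → suc ((3 + 2 * J) * (J + 0)) ≡ (1 + 2 * J) * suc J + 0 * (2 + 2 * J)
  even = solve-∀
exponent-identity (suc zero) J (s≤s z≤n) = odd J
  where
  odd : ∀ J → suc ((4 + 2 * J) * (J + 1)) ≡ (2 + 2 * J) * suc J + 1 * (3 + 2 * J)
  odd = solve-∀

-- Split n^(k-2) = n^(J+1)·n^(J+b), trade n^(J+b) for a^(k(J+b)), and compare exponents.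
power-estimate : ∀ {n a} k b J → k ≡ 3 + b + 2 * J → b ≤ 1 → n ≤ a ^ k →
  n ^ (k ∸ 2) * a ≤ (n * a ^ (k ∸ 2)) ^ suc J * (a ^ b) ^ (k ∸ 1)
power-estimate {n} {a} k b J refl b≤1 n≤aᵏ = begin
  n ^ p * a                                    ≡⟨ cong (λ e → n ^ e * a) (split b J) ⟩
  n ^ (suc J + (J + b)) * a                    ≡⟨ cong (_* a) (^-distribˡ-+-* n (suc J) (J + b)) ⟩
  n ^ suc J * n ^ (J + b) * a                  ≡⟨ xy∙z≈x∙zy (n ^ suc J) (n ^ (J + b)) a ⟩
  n ^ suc J * (a * n ^ (J + b))                ≤⟨ *-monoʳ-≤ (n ^ suc J) (*-monoʳ-≤ a (^-monoˡ-≤ (J + b) n≤aᵏ)) ⟩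
  n ^ suc J * (a * (a ^ k) ^ (J + b))          ≡⟨ cong (λ x → n ^ suc J * (a * x)) (^-*-assoc a k (J + b)) ⟩
  n ^ suc J * a ^ suc (k * (J + b))            ≡⟨ cong (λ e → n ^ suc J * a ^ e) (exponent-identity b J b≤1) ⟩
  n ^ suc J * a ^ (p * suc J + b * suc p)      ≡⟨ cong (n ^ suc J *_) (^-distribˡ-+-* a (p * suc J) (b * suc p)) ⟩
  n ^ suc J * (a ^ (p * suc J) * a ^ (b * suc p)) ≡⟨ sym (*-assoc (n ^ suc J) _ _) ⟩
  n ^ suc J * a ^ (p * suc J) * a ^ (b * suc p)   ≡⟨ cong₂ _*_ (sym distribute) (sym (^-*-assoc a b (suc p))) ⟩
  (n * a ^ p) ^ suc J * (a ^ b) ^ suc p        ∎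
  where
  open ≤-Reasoning
  p = 1 + b + 2 * J
  split : ∀ b J → 1 + b + 2 * J ≡ suc J + (J + b)
  split = solve-∀
  distribute : (n * a ^ p) ^ suc J ≡ n ^ suc J * a ^ (p * suc J)
  distribute = trans (*-^-distrib n (a ^ p) (suc J)) (cong (n ^ suc J *_) (^-*-assoc a p (suc J)))

decompose : ∀ k → 3 ≤ k → k ≡ 3 + (k ∸ 3) % 2 + 2 * ((k ∸ 3) / 2)
decompose (suc (suc (suc r))) (s≤s (s≤s (s≤s _))) =
  cong (3 +_) (trans (m≡m%n+[m/n]*n r 2) (cong (r % 2 +_) (*-comm (r / 2) 2)))

innermost-index : ∀ k b J → k ≡ 3 + b + 2 * J → k ∸ 2 * suc J ∸ 1 ≡ b
innermost-index k b J refl =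
  trans (∸-+-assoc k (2 * suc J) 1) (trans (cong (_∸ (2 * suc J + 1)) (regroup b J)) (m+n∸n≡m b (2 * suc J + 1)))
  where
  regroup : ∀ b J → 3 + b + 2 * J ≡ b + (2 * suc J + 1)
  regroup = solve-∀

next-shell-index : ∀ k j → k ∸ 2 * suc j ∸ 1 ≡ k ∸ 2 * j ∸ 3
next-shell-index k j =
  trans (∸-+-assoc k (2 * suc j) 1) (trans (cong (k ∸_) (regroup j)) (sym (∸-+-assoc k (2 * j) 3)))
  where
  regroup : ∀ j → 2 * suc j + 1 ≡ 2 * j + 3
  regroup = solve-∀

module _ {n : ℕ} (G : Graph n) (v : Fin n) where

  small-sphere : ∀ b → b ≤ 1 → d G b v ≡ d G 1 v ^ b
  small-sphere zero       _         = ∣⁅x⁆∣≡1 v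
  small-sphere (suc zero) (s≤s z≤n) = sym (*-identityʳ (d G 1 v))

  shellPower : ℕ → ℕ → ℕ
  shellPower k j = d G (k ∸ 2 * j ∸ 1) v ^ (k ∸ 1)

  high-from-step : ∀ k j → shellPower k j ≤ n * d G 1 v ^ (k ∸ 2) * shellPower k (suc j) → Vhigh G k j v
  high-from-step k j step =
    subst (λ i → shellPower k j ≤ n * d G i v ^ (k ∸ 1) * d G 1 v ^ (k ∸ 2)) (next-shell-index k j)
      (subst (shellPower k j ≤_) (xy∙z≈xz∙y n (d G 1 v ^ (k ∸ 2)) (shellPower k (suc j))) step)

  med-from-bound : ∀ k b J → k ≡ 3 + b + 2 * J → b ≤ 1 → n ≤ d G 1 v ^ k →
    (n * d G 1 v ^ (k ∸ 2)) ^ suc J * shellPower k (suc J) ≤ shellPower k 0 → Vmed G k v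
  med-from-bound k b J k≡ b≤1 n≤aᵏ bound =
    ≤-trans (power-estimate k b J k≡ b≤1 n≤aᵏ)
      (subst (λ x → (n * d G 1 v ^ (k ∸ 2)) ^ suc J * x ≤ shellPower k 0) innermost bound)
    where
    innermost : shellPower k (suc J) ≡ (d G 1 v ^ b) ^ (k ∸ 1)
    innermost = cong (_^ (k ∸ 1)) (trans (cong (λ i → d G i v) (innermost-index k b J k≡)) (small-sphere b b≤1))

  covering : ∀ k b J → k ≡ 3 + b + 2 * J → b ≤ 1 →
    Vlow G k v ⊎ Vmed G k v ⊎ Σ ℕ (λ j → (j ≤ J) × Vhigh G k j v)
  covering k b J k≡ b≤1 with d G 1 v ^ k ≤? n
  ... | yes low = inj₁ low
  ... | no notLow with telescope (n * d G 1 v ^ (k ∸ 2)) (shellPower k) (suc J)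
  ...   | inj₁ (j , j<J+1 , step) = inj₂ (inj₂ (j , s≤s⁻¹ j<J+1 , high-from-step k j step))
  ...   | inj₂ bound = inj₂ (inj₁ (med-from-bound k b J k≡ b≤1 (<⇒≤ (≰⇒> notLow)) bound))

theorem7 : (k : ℕ) → 3 ≤ k → (n : ℕ) → (G : Graph n) → GirthAtLeast G (2 * k + 1) →
    (v : Fin n) →
      Vlow G k v ⊎ Vmed G k v ⊎ Σ ℕ (λ j → (j ≤ (k ∸ 3) / 2) × Vhigh G k j v)
theorem7 k 3≤k n G _ v =
  covering G v k ((k ∸ 3) % 2) ((k ∸ 3) / 2) (decompose k 3≤k) (s≤s⁻¹ (m%n<n (k ∸ 3) 2))
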